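{- Let $D$ be a connected digraph such that for every vertex $x$ both $x^+$ and $x^-$ induce semicomplete digraphs, and such that some maximal weak hub of $D$ is mixed. Then there exists a partition of $V(D)$ into four sets $E,F,G,H$ such that: $F$ and $H$ are non-empty and at least one of $E$ and $G$ is non-empty; $D[E],D[F],D[G],D[H]$ are semicomplete; $E$ strictly out-dominates $F$, $F$ strictly out-dominates $G$, $G$ out-dominates $H$, and $H$ out-dominates $E$; and for every $x\in G$, $x^+\cap E\ne\emptyset$ and $x^-\cap E\neq\emptyset$.
   Context: Digraphs have no loops and no multiple arcs, but digons are allowed. $x^+=\{y:xy\text{ arc}\}$, $x^-=\{y:yx\text{ arc}\}$. Connected means the underlying undirected graph is connected; strongly connected means there is a directed path between every ordered pair of vertices. Semicomplete: any two distinct vertices are joined by at least one arc. A vertex $x$ out-dominates a set $X$ if $X\subseteq x^+$, strictly out-dominates $X$ if $X\subseteq x^+\setminus x^-$, and strictly in-dominates $X$ if $X\subseteq x^-\setminus x^+$; a set $Y$ (strictly) out-dominates $X$ if every vertex of $Y$ does. A weak hub is a set $X\subseteq V(D)$ such that $D[X]$ is strongly connected and some vertex strictly in-dominates or strictly out-dominates $X$; a maximal weak hub is one maximal under inclusion. A weak hub $X$ is mixed if there are $x\notin X$ and $u,v\in X$ with $xu$ and $vx$ arcs. -}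

module Defs where

open import Data.Nat using (ℕ)
open import Data.Bool using (Bool; true; false; T)
open import Data.Fin using (Fin)
open import Data.Fin.Subset using (Subset; _∈_; _∉_; _⊆_)
open import Data.Product using (Σ; _×_; _,_; ∃; ∃-syntax)
open import Data.Sum using (_⊎_)
open import Data.Empty using (⊥)
open import Relation.Nullary using (¬_)
open import Relation.Binary.PropositionalEquality using (_≡_; _≢_)

-- A (finite) digraph on vertex set Fin n: no loops; no multiple arcs is
-- automatic since arcs form a relation; digons are allowed.
record Digraph (n : ℕ) : Set where
  field
    arc     : Fin n → Fin n → Bool
    loopless : ∀ x → arc x x ≡ false

open Digraph public

-- labels of the four parts; a partition of V(D) into E,F,G,H is a map
-- Fin n → Part (each vertex lies in exactly one part)
data Part : Set where
  pE pF pG pH : Part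

module _ {n : ℕ} (D : Digraph n) where

  Arc : Fin n → Fin n → Set
  Arc x y = T (arc D x y)

  InOut : Fin n → Fin n → Set
  InOut x y = Arc x y

  InIn : Fin n → Fin n → Set
  InIn x y = Arc y x

  data DPath (P : Fin n → Set) : Fin n → Fin n → Set where
    here : ∀ {x} → P x → DPath P x x
    step : ∀ {x y z} → P x → Arc x y → DPath P y z → DPath P x z

  data UPath : Fin n → Fin n → Set where
    here : ∀ {x} → UPath x x
    step : ∀ {x y z} → (Arc x y ⊎ Arc y x) → UPath y z → UPath x z

  Connected : Set
  Connected = ∀ x y → UPath x y

  StronglyConnectedOn : (Fin n → Set) → Set
  StronglyConnectedOn P = ∀ x y → P x → P y → DPath P x y

  SemicompleteOn : (Fin n → Set) → Set
  SemicompleteOn P = ∀ x y → P x → P y → x ≢ y → Arc x y ⊎ Arc y x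

  OutDom : Fin n → (Fin n → Set) → Set
  OutDom x P = ∀ y → P y → Arc x y

  StrictOutDom : Fin n → (Fin n → Set) → Set
  StrictOutDom x P = ∀ y → P y → Arc x y × ¬ Arc y x

  StrictInDom : Fin n → (Fin n → Set) → Set
  StrictInDom x P = ∀ y → P y → Arc y x × ¬ Arc x y

  SetOutDom : (Fin n → Set) → (Fin n → Set) → Set
  SetOutDom Q P = ∀ x → Q x → OutDom x P

  SetStrictOutDom : (Fin n → Set) → (Fin n → Set) → Set
  SetStrictOutDom Q P = ∀ x → Q x → StrictOutDom x P

  WeakHub : Subset n → Set
  WeakHub X = StronglyConnectedOn (_∈ X)
            × ∃[ z ] (StrictInDom z (_∈ X) ⊎ StrictOutDom z (_∈ X))

  MaximalWeakHub : Subset n → Set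
  MaximalWeakHub X = WeakHub X × (∀ Y → WeakHub Y → X ⊆ Y → Y ⊆ X)

  Mixed : Subset n → Set
  Mixed X = ∃[ x ] ∃[ u ] ∃[ v ] (x ∉ X × u ∈ X × v ∈ X × Arc x u × Arc v x)

  NonEmpty : (Fin n → Set) → Set
  NonEmpty P = ∃[ x ] P x

-- Let X be a maximal weak hub and m₀ a mixed vertex. Because the neighbourhoods are
-- semicomplete, arcs between a vertex w ∉ X and the strongly connected set X propagate
-- along X: if w has in-neighbours but no out-neighbours in X, it strictly in-dominates X,
-- and symmetrically. Walking from X along the underlying graph, every vertex is therefore
-- in X, strictly in-dominates X (class O), strictly out-dominates X (class I), or is mixed
-- (class M). Maximality of X forbids any vertex to strictly dominate X ∪ {m} for a mixed
-- m, which forces arcs O → M → I. If moreover no arc goes from M back to O and I ≠ ∅, the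
-- partition E = X, F = O, G = M, H = I works. In every other case some vertex c is
-- adjacent to all others, and E = {c}, F = the strict out-neighbours of c, H = the rest,
-- G = ∅ works.
module Submission where

open import Defs
open import Data.Nat using (ℕ)
open import Data.Fin using (Fin)
open import Data.Fin.Subset using (Subset)
open import Data.Product using (Σ; _×_; _,_; ∃; ∃-syntax)
open import Data.Sum using (_⊎_)
open import Relation.Binary.PropositionalEquality using (_≡_)

open import Data.Bool using (T)
open import Data.Empty using (⊥; ⊥-elim)
open import Data.Fin.Properties using (all?; any?) renaming (_≟_ to _≟ᶠ_)
open import Data.Fin.Subset using (_∈_; ⁅_⁆; _∪_)
open import Data.Fin.Subset.Properties using (_∈?_; x∈⁅x⁆; x∈⁅y⁆⇒x≡y; x∈p∪q⁻; p⊆p∪q; q⊆p∪q)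
open import Data.Product using (proj₁; proj₂)
open import Data.Sum using (inj₁; inj₂; swap; [_,_]′) renaming (map to ⊎-map)
open import Function using (_∘_; id)
open import Relation.Binary.PropositionalEquality using (refl; sym; subst; _≢_)
open import Relation.Nullary using (¬_; Dec; yes; no; contradiction)
open import Relation.Nullary.Decidable using (T?; ¬?; _×-dec_; _⊎-dec_; _→-dec_; decidable-stable)
open import Relation.Unary using (Decidable; _≐_)

fibre : ∀ {n} → (Fin n → Part) → Part → Fin n → Set
fibre part p v = part v ≡ p

module _ {n : ℕ} (D : Digraph n) where

  ¬loop : ∀ {x} → ¬ Arc D x x
  ¬loop {x} = subst T (loopless D x)

  Adjacent : Fin n → Fin n → Set
  Adjacent x y = Arc D x y ⊎ Arc D y x

  adjacent? : ∀ x y → Dec (Adjacent x y)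
  adjacent? x y = T? (arc D x y) ⊎-dec T? (arc D y x)

  Universal : Fin n → Set
  Universal c = ∀ w → w ≢ c → Adjacent c w

  HasInNeighbourIn HasOutNeighbourIn : (Fin n → Set) → Fin n → Set
  HasInNeighbourIn P w = ∃[ x ] (P x × Arc D x w)
  HasOutNeighbourIn P w = ∃[ x ] (P x × Arc D w x)

  MixedVertex : (Fin n → Set) → Fin n → Set
  MixedVertex P w = ¬ P w × HasOutNeighbourIn P w × HasInNeighbourIn P w

  hasInNeighbourIn? : ∀ {P} → Decidable P → Decidable (HasInNeighbourIn P)
  hasInNeighbourIn? P? w = any? (λ x → P? x ×-dec T? (arc D x w))

  hasOutNeighbourIn? : ∀ {P} → Decidable P → Decidable (HasOutNeighbourIn P)
  hasOutNeighbourIn? P? w = any? (λ x → P? x ×-dec T? (arc D w x))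

  mixedVertex? : ∀ {P} → Decidable P → Decidable (MixedVertex P)
  mixedVertex? P? w = ¬? (P? w) ×-dec hasOutNeighbourIn? P? w ×-dec hasInNeighbourIn? P? w

  strictInDom? : ∀ {P} → Decidable P → Decidable (λ w → StrictInDom D w P)
  strictInDom? P? w = all? (λ y → P? y →-dec (T? (arc D y w) ×-dec ¬? (T? (arc D w y))))

  strictOutDom? : ∀ {P} → Decidable P → Decidable (λ w → StrictOutDom D w P)
  strictOutDom? P? w = all? (λ y → P? y →-dec (T? (arc D w y) ×-dec ¬? (T? (arc D y w))))

  strictInDom⇒∉ : ∀ {P w} → StrictInDom D w P → ¬ P w
  strictInDom⇒∉ {w = w} dom Pw = ¬loop (proj₁ (dom w Pw))

  strictOutDom⇒∉ : ∀ {P w} → StrictOutDom D w P → ¬ P w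
  strictOutDom⇒∉ {w = w} dom Pw = ¬loop (proj₁ (dom w Pw))

  DPath-source : ∀ {P a b} → DPath D P a b → P a
  DPath-source (here Pa) = Pa
  DPath-source (step Pa _ _) = Pa

  DPath-map : ∀ {P Q} → (∀ {x} → P x → Q x) → ∀ {a b} → DPath D P a b → DPath D Q a b
  DPath-map f (here Pa) = here (f Pa)
  DPath-map f (step Pa ab path) = step (f Pa) ab (DPath-map f path)

  DPath-++ : ∀ {P a b c} → DPath D P a b → DPath D P b c → DPath D P a c
  DPath-++ (here _) path = path
  DPath-++ (step Pa ab path) path′ = step Pa ab (DPath-++ path path′)

  IsFourPartition : (Part → Fin n → Set) → Set
  IsFourPartition S =
    let E = S pE
        F = S pF
        G = S pG
        H = S pH
    in NonEmpty D F × NonEmpty D H × (NonEmpty D E ⊎ NonEmpty D G)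
     × SemicompleteOn D E × SemicompleteOn D F
     × SemicompleteOn D G × SemicompleteOn D H
     × SetStrictOutDom D E F × SetStrictOutDom D F G
     × SetOutDom D G H × SetOutDom D H E
     × (∀ x → G x → (∃[ y ] (E y × Arc D x y)) × (∃[ y ] (E y × Arc D y x)))

  FourPartition : Set
  FourPartition = Σ (Fin n → Part) λ part → IsFourPartition (fibre part)

  isFourPartition-≐ : ∀ {S S′} → (∀ p → S p ≐ S′ p) → IsFourPartition S → IsFourPartition S′
  isFourPartition-≐ {S} {S′} S≐S′
    (F≠∅ , H≠∅ , E⊎G≠∅ , scE , scF , scG , scH , E⇉F , F⇉G , G→H , H→E , G↔E) =
      nonEmpty F≠∅ , nonEmpty H≠∅ , ⊎-map nonEmpty nonEmpty E⊎G≠∅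
    , semicomplete scE , semicomplete scF , semicomplete scG , semicomplete scH
    , between E⇉F , between F⇉G , between G→H , between H→E
    , λ x G′x → let (out , in′) = G↔E x (from pG G′x) in witness out , witness in′
    where
      to : ∀ p {x} → S p x → S′ p x
      to p = proj₁ (S≐S′ p)
      from : ∀ p {x} → S′ p x → S p x
      from p = proj₂ (S≐S′ p)
      nonEmpty : ∀ {p} → NonEmpty D (S p) → NonEmpty D (S′ p)
      nonEmpty (x , Sx) = x , to _ Sx
      witness : ∀ {p} {R : Fin n → Set} → ∃[ x ] (S p x × R x) → ∃[ x ] (S′ p x × R x)
      witness (x , Sx , Rx) = x , to _ Sx , Rx
      semicomplete : ∀ {p} → SemicompleteOn D (S p) → SemicompleteOn D (S′ p)
      semicomplete sc x y S′x S′y = sc x y (from _ S′x) (from _ S′y)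
      between : ∀ {p q} {R : Fin n → Fin n → Set} →
                (∀ x → S p x → ∀ y → S q y → R x y) → (∀ x → S′ p x → ∀ y → S′ q y → R x y)
      between R-all x S′x y S′y = R-all x (from _ S′x) y (from _ S′y)

  partition-from-cover : ∀ {S} → (cover : ∀ w → ∃[ p ] S p w) →
                         (∀ {p q w} → S p w → S q w → p ≡ q) →
                         IsFourPartition S → FourPartition
  partition-from-cover {S} cover disjoint S-partition =
    proj₁ ∘ cover , isFourPartition-≐ fibre≐S S-partition
    where
      fibre≐S : ∀ p → S p ≐ fibre (proj₁ ∘ cover) p
      fibre≐S p = (λ {w} Spw → disjoint (proj₂ (cover w)) Spw)
                , (λ {w} eq → subst (λ q → S q w) eq (proj₂ (cover w)))

module Semicomplete {n : ℕ} (D : Digraph n)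
  (out-sc : ∀ x → SemicompleteOn D (InOut D x))
  (in-sc : ∀ x → SemicompleteOn D (InIn D x)) where

  ≡-or-adjacent-out : ∀ {s a b} → Arc D s a → Arc D s b → a ≡ b ⊎ Adjacent D a b
  ≡-or-adjacent-out {s} {a} {b} sa sb with a ≟ᶠ b
  ... | yes a≡b = inj₁ a≡b
  ... | no a≢b = inj₂ (out-sc s a b sa sb a≢b)

  ≡-or-adjacent-in : ∀ {s a b} → Arc D a s → Arc D b s → a ≡ b ⊎ Adjacent D a b
  ≡-or-adjacent-in {s} {a} {b} as bs with a ≟ᶠ b
  ... | yes a≡b = inj₁ a≡b
  ... | no a≢b = inj₂ (in-sc s a b as bs a≢b)

  StarClass : Fin n → Part → Fin n → Set
  StarClass c pE w = w ≡ c
  StarClass c pF w = Arc D c w × ¬ Arc D w c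
  StarClass c pG w = ⊥
  StarClass c pH w = Arc D w c

  starClass-cover : ∀ {c} → Universal D c → ∀ w → ∃[ p ] StarClass c p w
  starClass-cover {c} universal w with w ≟ᶠ c | T? (arc D c w) | T? (arc D w c)
  ... | yes w≡c | _ | _ = pE , w≡c
  ... | no _ | yes cw | no ¬wc = pF , cw , ¬wc
  ... | no _ | _ | yes wc = pH , wc
  ... | no w≢c | no ¬cw | no ¬wc = contradiction (universal w w≢c) [ ¬cw , ¬wc ]′

  starClass-disjoint : ∀ {c p q w} → StarClass c p w → StarClass c q w → p ≡ q
  starClass-disjoint {p = pE} {pE} _ _ = refl
  starClass-disjoint {p = pE} {pF} refl (cc , _) = ⊥-elim (¬loop D cc)
  starClass-disjoint {p = pE} {pH} refl cc = ⊥-elim (¬loop D cc)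
  starClass-disjoint {p = pF} {pE} (cc , _) refl = ⊥-elim (¬loop D cc)
  starClass-disjoint {p = pF} {pF} _ _ = refl
  starClass-disjoint {p = pF} {pH} (_ , ¬wc) wc = contradiction wc ¬wc
  starClass-disjoint {p = pH} {pE} cc refl = ⊥-elim (¬loop D cc)
  starClass-disjoint {p = pH} {pF} wc (_ , ¬wc) = contradiction wc ¬wc
  starClass-disjoint {p = pH} {pH} _ _ = refl
  starClass-disjoint {p = pG} () _
  starClass-disjoint {q = pG} _ ()

  star-partition : ∀ {c f h} → Universal D c → Arc D c f → ¬ Arc D f c → Arc D h c → FourPartition D
  star-partition {c} {f} {h} universal cf ¬fc hc =
    partition-from-cover D (starClass-cover universal) starClass-disjoint
      ( (f , cf , ¬fc) , (h , hc) , inj₁ (c , refl)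
      , (λ { x y refl refl x≢y → contradiction refl x≢y })
      , (λ x y cx cy → out-sc c x y (proj₁ cx) (proj₁ cy))
      , (λ _ _ ())
      , in-sc c
      , (λ { x refl y Fy → Fy })
      , (λ _ _ _ ())
      , (λ _ ())
      , (λ { x xc y refl → xc })
      , (λ _ ()) )

  arc-to-path-target⇒arc-to-source : ∀ {P w a b} → ¬ P w → ¬ HasInNeighbourIn D P w →
                                      DPath D P a b → Arc D w b → Arc D w a
  arc-to-path-target⇒arc-to-source ¬Pw no-in (here _) wb = wb
  arc-to-path-target⇒arc-to-source ¬Pw no-in (step {a} {y} Pa ay path) wb
    with in-sc y _ a (arc-to-path-target⇒arc-to-source ¬Pw no-in path wb) ay (λ { refl → ¬Pw Pa })
  ... | inj₁ wa = wa
  ... | inj₂ aw = contradiction (a , Pa , aw) no-in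

  arc-from-path-source⇒arc-from-target : ∀ {P w a b} → ¬ P w → ¬ HasOutNeighbourIn D P w →
                                          DPath D P a b → Arc D a w → Arc D b w
  arc-from-path-source⇒arc-from-target ¬Pw no-out (here _) aw = aw
  arc-from-path-source⇒arc-from-target ¬Pw no-out (step {a} {y} Pa ay path) aw
    with out-sc a _ y aw ay (λ { refl → ¬Pw (DPath-source D path) })
  ... | inj₁ wy = contradiction (y , DPath-source D path , wy) no-out
  ... | inj₂ yw = arc-from-path-source⇒arc-from-target ¬Pw no-out path yw

  ¬inNeighbour⇒strictOutDom : ∀ {P w} → StronglyConnectedOn D P → ¬ P w →
                              ¬ HasInNeighbourIn D P w → HasOutNeighbourIn D P w → StrictOutDom D w P
  ¬inNeighbour⇒strictOutDom strong ¬Pw no-in (b , Pb , wb) a Pa =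
    arc-to-path-target⇒arc-to-source ¬Pw no-in (strong a b Pa Pb) wb , λ aw → no-in (a , Pa , aw)

  ¬outNeighbour⇒strictInDom : ∀ {P w} → StronglyConnectedOn D P → ¬ P w →
                              ¬ HasOutNeighbourIn D P w → HasInNeighbourIn D P w → StrictInDom D w P
  ¬outNeighbour⇒strictInDom strong ¬Pw no-out (a , Pa , aw) b Pb =
    arc-from-path-source⇒arc-from-target ¬Pw no-out (strong a b Pa Pb) aw , λ wb → no-out (b , Pb , wb)

module _ {n} {X : Subset n} {m : Fin n} where

  ∈-insert⁻ : ∀ {x} → x ∈ ⁅ m ⁆ ∪ X → x ≡ m ⊎ x ∈ X
  ∈-insert⁻ x∈ = ⊎-map (x∈⁅y⁆⇒x≡y m) id (x∈p∪q⁻ ⁅ m ⁆ X x∈)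

  m∈insert : m ∈ ⁅ m ⁆ ∪ X
  m∈insert = p⊆p∪q X (x∈⁅x⁆ m)

  ⊆-insert : ∀ {x} → x ∈ X → x ∈ ⁅ m ⁆ ∪ X
  ⊆-insert = q⊆p∪q ⁅ m ⁆ X

  insert-stronglyConnected : ∀ {D : Digraph n} → StronglyConnectedOn D (_∈ X) →
                             MixedVertex D (_∈ X) m → StronglyConnectedOn D (_∈ ⁅ m ⁆ ∪ X)
  insert-stronglyConnected {D} strong (_ , (u , u∈X , mu) , (v , v∈X , vm)) a b a∈ b∈
    with ∈-insert⁻ a∈ | ∈-insert⁻ b∈
  ... | inj₁ refl | inj₁ refl = here m∈insert
  ... | inj₁ refl | inj₂ b∈X = step m∈insert mu (DPath-map D ⊆-insert (strong u b u∈X b∈X))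
  ... | inj₂ a∈X | inj₁ refl =
    DPath-++ D (DPath-map D ⊆-insert (strong a v a∈X v∈X)) (step (⊆-insert v∈X) vm (here m∈insert))
  ... | inj₂ a∈X | inj₂ b∈X = DPath-map D ⊆-insert (strong a b a∈X b∈X)

  strictInDom-insert : ∀ {D : Digraph n} {o} → StrictInDom D o (_∈ X) → Arc D m o → ¬ Arc D o m →
                       StrictInDom D o (_∈ ⁅ m ⁆ ∪ X)
  strictInDom-insert o-dom mo ¬om y y∈ with ∈-insert⁻ y∈
  ... | inj₁ refl = mo , ¬om
  ... | inj₂ y∈X = o-dom y y∈X

  strictOutDom-insert : ∀ {D : Digraph n} {i} → StrictOutDom D i (_∈ X) → Arc D i m → ¬ Arc D m i →
                        StrictOutDom D i (_∈ ⁅ m ⁆ ∪ X)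
  strictOutDom-insert i-dom im ¬mi y y∈ with ∈-insert⁻ y∈
  ... | inj₁ refl = im , ¬mi
  ... | inj₂ y∈X = i-dom y y∈X

module MaximalHub {n : ℕ} (D : Digraph n)
  (out-sc : ∀ x → SemicompleteOn D (InOut D x))
  (in-sc : ∀ x → SemicompleteOn D (InIn D x))
  {X : Subset n} (maximal : MaximalWeakHub D X) where

  open Semicomplete D out-sc in-sc

  strong : StronglyConnectedOn D (_∈ X)
  strong = proj₁ (proj₁ maximal)

  insert-mixed-undominated : ∀ {m w} → MixedVertex D (_∈ X) m →
    ¬ (StrictInDom D w (_∈ ⁅ m ⁆ ∪ X) ⊎ StrictOutDom D w (_∈ ⁅ m ⁆ ∪ X))
  insert-mixed-undominated {w = w} m-mixed dom =
    proj₁ m-mixed (proj₂ maximal _ (insert-stronglyConnected strong m-mixed , w , dom) ⊆-insert m∈insert)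

  strictInDom⇒arc-to-mixed : ∀ {o m} → StrictInDom D o (_∈ X) → MixedVertex D (_∈ X) m → Arc D o m
  strictInDom⇒arc-to-mixed {o} {m} o-dom m-mixed@(_ , (u , u∈X , mu) , (v , v∈X , vm))
    with T? (arc D o m)
  ... | yes om = om
  ... | no ¬om with out-sc v m o vm (proj₁ (o-dom v v∈X)) (λ { refl → proj₂ (o-dom u u∈X) mu })
  ...   | inj₁ mo =
    contradiction (inj₁ (strictInDom-insert {D = D} o-dom mo ¬om)) (insert-mixed-undominated m-mixed)
  ...   | inj₂ om = om

  strictOutDom⇒arc-from-mixed : ∀ {i m} → StrictOutDom D i (_∈ X) → MixedVertex D (_∈ X) m → Arc D m i
  strictOutDom⇒arc-from-mixed {i} {m} i-dom m-mixed@(_ , (u , u∈X , mu) , (v , v∈X , vm))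
    with T? (arc D m i)
  ... | yes mi = mi
  ... | no ¬mi with in-sc u m i mu (proj₁ (i-dom u u∈X)) (λ { refl → proj₂ (i-dom v v∈X) vm })
  ...   | inj₁ mi = mi
  ...   | inj₂ im =
    contradiction (inj₂ (strictOutDom-insert {D = D} i-dom im ¬mi)) (insert-mixed-undominated m-mixed)

  HubClass : Part → Fin n → Set
  HubClass pE w = w ∈ X
  HubClass pF w = StrictInDom D w (_∈ X)
  HubClass pG w = MixedVertex D (_∈ X) w
  HubClass pH w = StrictOutDom D w (_∈ X)

  hubClass? : ∀ p → Decidable (HubClass p)
  hubClass? pE = _∈? X
  hubClass? pF = strictInDom? D (_∈? X)
  hubClass? pG = mixedVertex? D (_∈? X)
  hubClass? pH = strictOutDom? D (_∈? X)

  NearHub : Fin n → Set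
  NearHub w = w ∈ X ⊎ HasInNeighbourIn D (_∈ X) w ⊎ HasOutNeighbourIn D (_∈ X) w

  near⇒hubClass : ∀ {w} → NearHub w → ∃[ p ] HubClass p w
  near⇒hubClass {w} near
    with w ∈? X | hasInNeighbourIn? D (_∈? X) w | hasOutNeighbourIn? D (_∈? X) w
  ... | yes w∈X | _ | _ = pE , w∈X
  ... | no w∉X | yes has-in | yes has-out = pG , w∉X , has-out , has-in
  ... | no w∉X | yes has-in | no no-out = pF , ¬outNeighbour⇒strictInDom strong w∉X no-out has-in
  ... | no w∉X | no no-in | yes has-out = pH , ¬inNeighbour⇒strictOutDom strong w∉X no-in has-out
  ... | no w∉X | no no-in | no no-out = contradiction near [ w∉X , [ no-in , no-out ]′ ]′

  near-≡-or-adjacent-hub : ∀ {x t} → x ∈ X → t ≡ x ⊎ Adjacent D t x → NearHub t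
  near-≡-or-adjacent-hub x∈X (inj₁ refl) = inj₁ x∈X
  near-≡-or-adjacent-hub x∈X (inj₂ (inj₁ tx)) = inj₂ (inj₂ (_ , x∈X , tx))
  near-≡-or-adjacent-hub x∈X (inj₂ (inj₂ xt)) = inj₂ (inj₁ (_ , x∈X , xt))

  near-≡-or-adjacent-mixed : ∀ {m t} → MixedVertex D (_∈ X) m → t ≡ m ⊎ Adjacent D t m → NearHub t
  near-≡-or-adjacent-mixed (_ , _ , has-in) (inj₁ refl) = inj₂ (inj₁ has-in)
  near-≡-or-adjacent-mixed (_ , (u , u∈X , mu) , _) (inj₂ (inj₂ mt)) =
    near-≡-or-adjacent-hub u∈X (≡-or-adjacent-out mt mu)
  near-≡-or-adjacent-mixed (_ , _ , (v , v∈X , vm)) (inj₂ (inj₁ tm)) =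
    near-≡-or-adjacent-hub v∈X (≡-or-adjacent-in tm vm)

  module MixedHub (connected : Connected D) {m₀ : Fin n} (m₀-mixed : MixedVertex D (_∈ X) m₀) where

    u₀ : Fin n
    u₀ = proj₁ (proj₁ (proj₂ m₀-mixed))

    u₀∈X : u₀ ∈ X
    u₀∈X = proj₁ (proj₂ (proj₁ (proj₂ m₀-mixed)))

    m₀u₀ : Arc D m₀ u₀
    m₀u₀ = proj₂ (proj₂ (proj₁ (proj₂ m₀-mixed)))

    arc-from-u₀ : ∀ {o} → HubClass pF o → Arc D u₀ o
    arc-from-u₀ o-in = proj₁ (o-in u₀ u₀∈X)

    arc-to-u₀ : ∀ {i} → HubClass pH i → Arc D i u₀
    arc-to-u₀ i-out = proj₁ (i-out u₀ u₀∈X)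

    -- A vertex of O or I is adjacent to both u₀ ∈ X and m₀, so each of its neighbours shares
    -- a semicomplete neighbourhood with u₀ or with m₀.
    near-step : ∀ {s t} → NearHub s → Adjacent D s t → NearHub t
    near-step near s~t with near⇒hubClass near | s~t
    ... | pE , s∈X | _ = near-≡-or-adjacent-hub s∈X (inj₂ (swap s~t))
    ... | pG , s-mixed | _ = near-≡-or-adjacent-mixed s-mixed (inj₂ (swap s~t))
    ... | pF , s-in | inj₁ st =
      near-≡-or-adjacent-mixed m₀-mixed (≡-or-adjacent-out st (strictInDom⇒arc-to-mixed s-in m₀-mixed))
    ... | pF , s-in | inj₂ ts = near-≡-or-adjacent-hub u₀∈X (≡-or-adjacent-in ts (arc-from-u₀ s-in))
    ... | pH , s-out | inj₁ st = near-≡-or-adjacent-hub u₀∈X (≡-or-adjacent-out st (arc-to-u₀ s-out))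
    ... | pH , s-out | inj₂ ts =
      near-≡-or-adjacent-mixed m₀-mixed (≡-or-adjacent-in ts (strictOutDom⇒arc-from-mixed s-out m₀-mixed))

    near-along : ∀ {a b} → NearHub a → UPath D a b → NearHub b
    near-along near here = near
    near-along near (step st path) = near-along (near-step near st) path

    hubClass : ∀ w → ∃[ p ] HubClass p w
    hubClass w = near⇒hubClass (near-along (inj₁ u₀∈X) (connected u₀ w))

    inDominator≢outDominator : ∀ {o i} → HubClass pF o → HubClass pH i → o ≢ i
    inDominator≢outDominator o-in i-out refl = contradiction (arc-from-u₀ o-in) (proj₂ (i-out u₀ u₀∈X))

    hubClass-disjoint : ∀ {p q w} → HubClass p w → HubClass q w → p ≡ q
    hubClass-disjoint {pE} {pE} _ _ = refl
    hubClass-disjoint {pF} {pF} _ _ = refl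
    hubClass-disjoint {pG} {pG} _ _ = refl
    hubClass-disjoint {pH} {pH} _ _ = refl
    hubClass-disjoint {pE} {pF} w∈X w-in = contradiction w∈X (strictInDom⇒∉ D w-in)
    hubClass-disjoint {pF} {pE} w-in w∈X = contradiction w∈X (strictInDom⇒∉ D w-in)
    hubClass-disjoint {pE} {pG} w∈X w-mixed = contradiction w∈X (proj₁ w-mixed)
    hubClass-disjoint {pG} {pE} w-mixed w∈X = contradiction w∈X (proj₁ w-mixed)
    hubClass-disjoint {pE} {pH} w∈X w-out = contradiction w∈X (strictOutDom⇒∉ D w-out)
    hubClass-disjoint {pH} {pE} w-out w∈X = contradiction w∈X (strictOutDom⇒∉ D w-out)
    hubClass-disjoint {pF} {pG} w-in (_ , (x , x∈X , wx) , _) = contradiction wx (proj₂ (w-in x x∈X))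
    hubClass-disjoint {pG} {pF} (_ , (x , x∈X , wx) , _) w-in = contradiction wx (proj₂ (w-in x x∈X))
    hubClass-disjoint {pH} {pG} w-out (_ , _ , (x , x∈X , xw)) = contradiction xw (proj₂ (w-out x x∈X))
    hubClass-disjoint {pG} {pH} (_ , _ , (x , x∈X , xw)) w-out = contradiction xw (proj₂ (w-out x x∈X))
    hubClass-disjoint {pF} {pH} w-in w-out = ⊥-elim (inDominator≢outDominator w-in w-out refl)
    hubClass-disjoint {pH} {pF} w-out w-in = ⊥-elim (inDominator≢outDominator w-in w-out refl)

    hubClass-partition : ∀ {z y} → HubClass pF z → HubClass pH y →
                         (∀ {o m} → HubClass pF o → HubClass pG m → ¬ Arc D m o) → FourPartition D
    hubClass-partition {z} {y} z-in y-out ¬M→O =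
      partition-from-cover D hubClass hubClass-disjoint
        ( (z , z-in) , (y , y-out) , inj₁ (u₀ , u₀∈X)
        , (λ a b a∈X b∈X → in-sc z a b (proj₁ (z-in a a∈X)) (proj₁ (z-in b b∈X)))
        , (λ a b a-in b-in → out-sc u₀ a b (arc-from-u₀ a-in) (arc-from-u₀ b-in))
        , (λ a b a-mixed b-mixed →
             out-sc z a b (strictInDom⇒arc-to-mixed z-in a-mixed) (strictInDom⇒arc-to-mixed z-in b-mixed))
        , (λ a b a-out b-out → in-sc u₀ a b (arc-to-u₀ a-out) (arc-to-u₀ b-out))
        , (λ x x∈X o o-in → o-in x x∈X)
        , (λ o o-in m m-mixed → strictInDom⇒arc-to-mixed o-in m-mixed , ¬M→O o-in m-mixed)
        , (λ m m-mixed i i-out → strictOutDom⇒arc-from-mixed i-out m-mixed)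
        , (λ i i-out x x∈X → proj₁ (i-out x x∈X))
        , (λ m (_ , has-out , has-in) → has-out , has-in) )

    outDominator-of-¬inDominator : ¬ ∃ (HubClass pF) → ∃ λ z → StrictOutDom D z (_∈ X)
    outDominator-of-¬inDominator no-in with proj₂ (proj₁ maximal)
    ... | z , inj₁ z-in = contradiction (z , z-in) no-in
    ... | z , inj₂ z-out = z , z-out

    star-at-outDominator : ∀ {z} → StrictOutDom D z (_∈ X) → ¬ ∃ (HubClass pF) → FourPartition D
    star-at-outDominator {z} z-out no-in =
      star-partition universal (arc-to-u₀ z-out) (proj₂ (z-out u₀ u₀∈X))
                     (strictOutDom⇒arc-from-mixed z-out m₀-mixed)
      where
        universal : Universal D z
        universal w w≢z with hubClass w
        ... | pE , w∈X = inj₁ (proj₁ (z-out w w∈X))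
        ... | pF , w-in = contradiction (w , w-in) no-in
        ... | pG , w-mixed = inj₂ (strictOutDom⇒arc-from-mixed z-out w-mixed)
        ... | pH , w-out = in-sc u₀ z w (arc-to-u₀ z-out) (arc-to-u₀ w-out) (w≢z ∘ sym)

    star-at-hubVertex : ∀ {z} → HubClass pF z → (∀ {m} → HubClass pG m → Adjacent D u₀ m) → FourPartition D
    star-at-hubVertex {z} z-in u₀~M =
      star-partition universal (arc-from-u₀ z-in) (proj₂ (z-in u₀ u₀∈X)) m₀u₀
      where
        universal : Universal D u₀
        universal w w≢u₀ with hubClass w
        ... | pE , w∈X = in-sc z u₀ w (arc-from-u₀ z-in) (proj₁ (z-in w w∈X)) (w≢u₀ ∘ sym)
        ... | pF , w-in = inj₁ (arc-from-u₀ w-in)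
        ... | pG , w-mixed = u₀~M w-mixed
        ... | pH , w-out = inj₂ (arc-to-u₀ w-out)

    star-at-inDominator : ∀ {o m} → HubClass pF o → (∀ {i} → HubClass pH i → Adjacent D o i) →
                          HubClass pG m → ¬ Adjacent D u₀ m → FourPartition D
    star-at-inDominator {o} {m} o-in o~I m-mixed u₀≁m =
      star-partition universal (strictInDom⇒arc-to-mixed o-in m-mixed) ¬mo (arc-from-u₀ o-in)
      where
        ¬mo : ¬ Arc D m o
        ¬mo mo = u₀≁m (swap (in-sc o m u₀ mo (arc-from-u₀ o-in) (λ { refl → proj₁ m-mixed u₀∈X })))
        universal : Universal D o
        universal w w≢o with hubClass w
        ... | pE , w∈X = inj₂ (proj₁ (o-in w w∈X))
        ... | pF , w-in = out-sc u₀ o w (arc-from-u₀ o-in) (arc-from-u₀ w-in) (w≢o ∘ sym)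
        ... | pG , w-mixed = inj₁ (strictInDom⇒arc-to-mixed o-in w-mixed)
        ... | pH , w-out = o~I w-out

    mixedHub-partition : FourPartition D
    mixedHub-partition with any? (hubClass? pF)
    ... | no no-in = star-at-outDominator (proj₂ (outDominator-of-¬inDominator no-in)) no-in
    ... | yes (z , z-in) with any? (λ m → hubClass? pG m ×-dec ¬? (adjacent? D u₀ m))
    ... | no u₀~M =
      star-at-hubVertex z-in
        (λ {m} m-mixed → decidable-stable (adjacent? D u₀ m) (λ u₀≁m → u₀~M (m , m-mixed , u₀≁m)))
    ... | yes (m , m-mixed , u₀≁m)
      with any? (λ o → any? (λ m′ → hubClass? pF o ×-dec hubClass? pG m′ ×-dec T? (arc D m′ o)))
    ...   | yes (o , m′ , o-in , m′-mixed , m′o) =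
      star-at-inDominator o-in
        (λ i-out → out-sc m′ _ _ m′o (strictOutDom⇒arc-from-mixed i-out m′-mixed)
                                       (inDominator≢outDominator o-in i-out))
        m-mixed u₀≁m
    ...   | no ¬M→O with any? (hubClass? pH)
    ...     | yes (y , y-out) =
      hubClass-partition z-in y-out (λ o-in m-mixed mo → ¬M→O (_ , _ , o-in , m-mixed , mo))
    ...     | no no-out =
      star-at-inDominator z-in (λ i-out → contradiction (_ , i-out) no-out) m-mixed u₀≁m

lemma4p7 : {n : ℕ} (D : Digraph n) →
    Connected D →
    (∀ x → SemicompleteOn D (InOut D x)) →
    (∀ x → SemicompleteOn D (InIn D x)) →
    (∃[ X ] (MaximalWeakHub D X × Mixed D X)) →
    Σ (Fin n → Part) λ part → (
      let E = λ (v : Fin n) → part v ≡ pE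
          F = λ (v : Fin n) → part v ≡ pF
          G = λ (v : Fin n) → part v ≡ pG
          H = λ (v : Fin n) → part v ≡ pH
      in NonEmpty D F × NonEmpty D H × (NonEmpty D E ⊎ NonEmpty D G)
       × SemicompleteOn D E × SemicompleteOn D F
       × SemicompleteOn D G × SemicompleteOn D H
       × SetStrictOutDom D E F × SetStrictOutDom D F G
       × SetOutDom D G H × SetOutDom D H E
       × (∀ x → G x → (∃[ y ] (E y × Arc D x y)) × (∃[ y ] (E y × Arc D y x))))
lemma4p7 D connected out-sc in-sc (X , maximal , (m , u , v , m∉X , u∈X , v∈X , mu , vm)) =
  MaximalHub.MixedHub.mixedHub-partition D out-sc in-sc maximal connected
    (m∉X , (u , u∈X , mu) , (v , v∈X , vm))
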